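{- Let $\Gamma$ be a set of formulas and $\phi$ a formula. (1) If $\phi$ is derivable from $\Gamma$ in the axiom system whose axioms are all propositional tautologies (in the language with $\Box$) and all instances of CM: $\Box_\phi(\psi\land\theta)\supset(\Box_\phi\psi\land\Box_\phi\theta)$, CC: $(\Box_\phi\psi\land\Box_\phi\theta)\supset\Box_\phi(\psi\land\theta)$, CN: $\Box_\phi\top$, and whose rules are modus ponens and RCEC (from $\psi\equiv\theta$ infer $\Box_\phi\psi\equiv\Box_\phi\theta$), then $\Gamma\vdash_{\mathbf{Ck}+\mathrm{cut}}\phi$. (2) If $\phi$ is derivable from $\Gamma$ in the system of (1) extended with the rule RCEA (from $\phi\equiv\psi$ infer $\Box_\phi\theta\equiv\Box_\psi\theta$), then $\Gamma\vdash_{\mathbf{CK}}\phi$.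
   Context: Formulas are built from propositional variables and $\bot$ using $\lnot,\supset,\land,\lor$ and a binary operator: if $\phi,\psi$ are formulas, so is $\Box_\phi\psi$. Abbreviations: $\top:=\lnot\bot$, $\Diamond_\phi\psi:=\lnot\Box_\phi\lnot\psi$, $\phi\equiv\psi:=(\phi\supset\psi)\land(\psi\supset\phi)$. In a derivation from premises $\Gamma$, the rules RCEC and RCEA are (as usual for such rules) applied only to formulas derivable without premises. Prefixed formulas are expressions $i\triangleright\phi$ and $i\,r_\phi\,j$, where $i,j$ are positive integer indices. The $\mathbf{Ck}$ rules (premises $\Rightarrow$ conclusions; "$|$" separates branches): $i\triangleright\phi\land\psi\Rightarrow i\triangleright\phi,\ i\triangleright\psi$; $i\triangleright\lnot(\phi\land\psi)\Rightarrow i\triangleright\lnot\phi\ |\ i\triangleright\lnot\psi$; $i\triangleright\phi\lor\psi\Rightarrow i\triangleright\phi\ |\ i\triangleright\psi$; $i\triangleright\lnot(\phi\lor\psi)\Rightarrow i\triangleright\lnot\phi,\ i\triangleright\lnot\psi$; $i\triangleright\phi\supset\psi\Rightarrow i\triangleright\lnot\phi\ |\ i\triangleright\psi$; $i\triangleright\lnot(\phi\supset\psi)\Rightarrow i\triangleright\phi,\ i\triangleright\lnot\psi$; $i\triangleright\lnot\lnot\phi\Rightarrow i\triangleright\phi$; ($\Box$) $i\triangleright\Box_\phi\psi$ and $i\,r_\phi\,j\Rightarrow j\triangleright\psi$; ($\lnot\Box$) $i\triangleright\lnot\Box_\phi\psi\Rightarrow i\,r_\phi\,j,\ j\triangleright\lnot\psi$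 with $j$ new to the branch; ($\Diamond$) $i\triangleright\Diamond_\phi\psi\Rightarrow i\,r_\phi\,j,\ j\triangleright\psi$ with $j$ new; ($\lnot\Diamond$) $i\triangleright\lnot\Diamond_\phi\psi$ and $i\,r_\phi\,j\Rightarrow j\triangleright\lnot\psi$. Further rules: (cut) no premises $\Rightarrow i\triangleright\phi\ |\ i\triangleright\lnot\phi$, for any formula $\phi$, where $i$ already occurs on the branch; (ea) $i\,r_\phi\,j\Rightarrow (k\triangleright\lnot\phi,\ k\triangleright\psi)\ |\ (k\triangleright\phi,\ k\triangleright\lnot\psi)\ |\ i\,r_\psi\,j$, for any formula $\psi$, with $k$ new to the branch. $\mathbf{Ck}+\mathrm{cut}$ is the $\mathbf{Ck}$ rules plus cut; $\mathbf{CK}$ is the $\mathbf{Ck}$ rules plus cut and ea. A tableau from a set of prefixed formulas is a downward-branching tree of prefixed formulas each of which is an assumption or a conclusion of a rule applied to formulas above it on its branch (all conclusions of a branching rule placed as siblings). A branch is closed if it contains $i\triangleright\theta$ and $i\triangleright\lnot\theta$ for some $i,\theta$, or contains $i\triangleright\bot$; a tableau is closed if all its branches are. $\Gamma\vdash_X\phi$ means there is a closed tableau using only rules of $X$ with assumptions $\{1\triangleright\psi:\psi\in\Gamma\}\cup\{1\triangleright\lnot\phi\}$. -}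

module Defs where

open import Data.Nat using (ℕ)
open import Data.Bool using (Bool; true; false; T; not; _∧_; _∨_)
open import Data.List using (List; []; _∷_; _++_)
open import Data.List.Membership.Propositional using (_∈_)
open import Data.List.Relation.Unary.Any using (Any)
open import Data.List.Relation.Unary.All using (All)
open import Data.Product using (Σ; _×_)
open import Data.Sum using (_⊎_)
open import Data.Empty using (⊥)
open import Relation.Nullary using (¬_)
open import Relation.Binary.PropositionalEquality using (_≡_)

infixr 6 _∧'_
infixr 5 _∨'_
infixr 4 _⊃_

data Fm : Set where
  var  : ℕ → Fm
  ⊥'   : Fm
  ¬'   : Fm → Fm
  _⊃_  : Fm → Fm → Fm
  _∧'_ : Fm → Fm → Fm
  _∨'_ : Fm → Fm → Fm
  □    : Fm → Fm → Fm          -- □ φ ψ  is  □_φ ψ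

⊤' : Fm
⊤' = ¬' ⊥'

◇ : Fm → Fm → Fm
◇ φ ψ = ¬' (□ φ (¬' ψ))

_≣_ : Fm → Fm → Fm
φ ≣ ψ = (φ ⊃ ψ) ∧' (ψ ⊃ φ)

-- Propositional tautologies: true under every Boolean valuation in which
-- propositional variables and formulas □_φ ψ are treated as atoms.

eval : (Fm → Bool) → Fm → Bool
eval v (var p)  = v (var p)
eval v ⊥'       = false
eval v (¬' φ)   = not (eval v φ)
eval v (φ ⊃ ψ)  = not (eval v φ) ∨ eval v ψ
eval v (φ ∧' ψ) = eval v φ ∧ eval v ψ
eval v (φ ∨' ψ) = eval v φ ∨ eval v ψ
eval v (□ φ ψ)  = v (□ φ ψ)

Tautology : Fm → Set
Tautology φ = (v : Fm → Bool) → eval v φ ≡ true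

-- RCEC / RCEA may only be applied to formulas derivable without premises.

NoPremises : Fm → Set
NoPremises _ = ⊥

data Der (rcea : Bool) : (Fm → Set) → Fm → Set₁ where
  prem : ∀ {Γ φ} → Γ φ → Der rcea Γ φ
  taut : ∀ {Γ φ} → Tautology φ → Der rcea Γ φ
  CM   : ∀ {Γ φ ψ θ} → Der rcea Γ (□ φ (ψ ∧' θ) ⊃ (□ φ ψ ∧' □ φ θ))
  CC   : ∀ {Γ φ ψ θ} → Der rcea Γ ((□ φ ψ ∧' □ φ θ) ⊃ □ φ (ψ ∧' θ))
  CN   : ∀ {Γ φ} → Der rcea Γ (□ φ ⊤')
  mp   : ∀ {Γ φ ψ} → Der rcea Γ (φ ⊃ ψ) → Der rcea Γ φ → Der rcea Γ ψ
  RCEC : ∀ {Γ φ ψ θ} → Der rcea NoPremises (ψ ≣ θ)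
       → Der rcea Γ (□ φ ψ ≣ □ φ θ)
  RCEA : ∀ {Γ φ ψ θ} → T rcea → Der rcea NoPremises (φ ≣ ψ)
       → Der rcea Γ (□ φ θ ≣ □ ψ θ)

infix 3 _▷_

data PF : Set where
  _▷_ : ℕ → Fm → PF
  rel : ℕ → Fm → ℕ → PF

indices : PF → List ℕ
indices (i ▷ φ)     = i ∷ []
indices (rel i φ j) = i ∷ j ∷ []

Branch : Set
Branch = List PF

Occurs : ℕ → Branch → Set
Occurs i B = Any (λ p → i ∈ indices p) B

Fresh : ℕ → Branch → Set
Fresh j B = ¬ Occurs j B

Closed : Branch → Set
Closed B = Σ ℕ (λ i → Σ Fm (λ θ → ((i ▷ θ) ∈ B) × ((i ▷ ¬' θ) ∈ B)))
         ⊎ Σ ℕ (λ i → (i ▷ ⊥') ∈ B)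

-- Rule B Cs : a rule instance whose premises lie on branch B and whose
-- conclusion branches are Cs (each a list of prefixed formulas added in
-- sequence; distinct elements of Cs are sibling branches).
-- Every rule includes Ck and cut; the flag ea says whether (ea) is allowed.
data Rule (ea : Bool) (B : Branch) : List (List PF) → Set where
  r∧   : ∀ {i φ ψ} → (i ▷ φ ∧' ψ) ∈ B
       → Rule ea B (((i ▷ φ) ∷ (i ▷ ψ) ∷ []) ∷ [])
  r¬∧  : ∀ {i φ ψ} → (i ▷ ¬' (φ ∧' ψ)) ∈ B
       → Rule ea B (((i ▷ ¬' φ) ∷ []) ∷ ((i ▷ ¬' ψ) ∷ []) ∷ [])
  r∨   : ∀ {i φ ψ} → (i ▷ φ ∨' ψ) ∈ B
       → Rule ea B (((i ▷ φ) ∷ []) ∷ ((i ▷ ψ) ∷ []) ∷ [])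
  r¬∨  : ∀ {i φ ψ} → (i ▷ ¬' (φ ∨' ψ)) ∈ B
       → Rule ea B (((i ▷ ¬' φ) ∷ (i ▷ ¬' ψ) ∷ []) ∷ [])
  r⊃   : ∀ {i φ ψ} → (i ▷ φ ⊃ ψ) ∈ B
       → Rule ea B (((i ▷ ¬' φ) ∷ []) ∷ ((i ▷ ψ) ∷ []) ∷ [])
  r¬⊃  : ∀ {i φ ψ} → (i ▷ ¬' (φ ⊃ ψ)) ∈ B
       → Rule ea B (((i ▷ φ) ∷ (i ▷ ¬' ψ) ∷ []) ∷ [])
  r¬¬  : ∀ {i φ} → (i ▷ ¬' (¬' φ)) ∈ B
       → Rule ea B (((i ▷ φ) ∷ []) ∷ [])
  r□   : ∀ {i j φ ψ} → (i ▷ □ φ ψ) ∈ B → rel i φ j ∈ B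
       → Rule ea B (((j ▷ ψ) ∷ []) ∷ [])
  r¬□  : ∀ {i j φ ψ} → (i ▷ ¬' (□ φ ψ)) ∈ B → Fresh j B
       → Rule ea B ((rel i φ j ∷ (j ▷ ¬' ψ) ∷ []) ∷ [])
  r◇   : ∀ {i j φ ψ} → (i ▷ ◇ φ ψ) ∈ B → Fresh j B
       → Rule ea B ((rel i φ j ∷ (j ▷ ψ) ∷ []) ∷ [])
  r¬◇  : ∀ {i j φ ψ} → (i ▷ ¬' (◇ φ ψ)) ∈ B → rel i φ j ∈ B
       → Rule ea B (((j ▷ ¬' ψ) ∷ []) ∷ [])
  cut  : ∀ {i} (φ : Fm) → Occurs i B
       → Rule ea B (((i ▷ φ) ∷ []) ∷ ((i ▷ ¬' φ) ∷ []) ∷ [])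
  rea  : ∀ {i j k φ} (ψ : Fm) → T ea → rel i φ j ∈ B → Fresh k B
       → Rule ea B (((k ▷ ¬' φ) ∷ (k ▷ ψ) ∷ [])
                   ∷ ((k ▷ φ) ∷ (k ▷ ¬' ψ) ∷ [])
                   ∷ (rel i ψ j ∷ [])
                   ∷ [])

-- Closes ea A B : the branch B (listed bottom-up, most recent first) can be
-- extended, using assumptions from A and rules, to a finite tableau all of
-- whose branches are closed.
data Closes (ea : Bool) (A : PF → Set) : Branch → Set where
  done   : ∀ {B} → Closed B → Closes ea A B
  assume : ∀ {B p} → A p → Closes ea A (p ∷ B) → Closes ea A B
  apply  : ∀ {B Cs} → Rule ea B Cs
         → All (λ C → Closes ea A (C ++ B)) Cs → Closes ea A B

Assumptions : (Fm → Set) → Fm → PF → Set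
Assumptions Γ φ p = Σ Fm (λ ψ → Γ ψ × (p ≡ (1 ▷ ψ))) ⊎ (p ≡ (1 ▷ ¬' φ))

-- Γ ⊢_X φ ; ea = false gives Ck + cut, ea = true gives CK
_⊢T[_]_ : (Fm → Set) → Bool → Fm → Set
Γ ⊢T[ ea ] φ = Closes ea (Assumptions Γ φ) []

-- Call φ *refutable at world i* if every branch carrying
-- i ▷ ¬φ can be closed.  By induction on derivations we show that every
-- formula derivable from Γ is refutable at a world i at which all premises
-- of Γ may be assumed; the theorem is the instance i = 1.
--   * Tableau rules are packaged as combinators in continuation-passing
--     style: a rule application hands its conclusions, together with the
--     inclusion of the old branch into the new one, to a continuation.
--   * Propositional tautologies: cutting on every atom of φ produces
--     branches, each deciding the atoms by a Boolean valuation v; since φ is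
--     true under v, the formula ¬φ is broken down to a clash with an atom.
module Submission where

open import Defs
open import Data.Bool using (Bool; true; false; T; not)
open import Data.Nat using (ℕ; suc)
import Data.Nat.Properties as ℕ
open import Data.List using (List; []; _∷_; _++_; map; concat)
open import Data.List.Extrema.Nat using (max; xs≤max)
open import Data.List.Membership.Propositional using (_∈_)
open import Data.List.Membership.Propositional.Properties using (∈-concat⁺)
open import Data.List.Relation.Binary.Subset.Propositional using (_⊆_)
open import Data.List.Relation.Binary.Subset.Propositional.Properties using (⊆-refl; ⊆-trans)
open import Data.List.Relation.Unary.Any using (here; there)
import Data.List.Relation.Unary.Any as Any
open import Data.List.Relation.Unary.Any.Properties using (map⁺)
open import Data.List.Relation.Unary.All using (All; []; _∷_)
import Data.List.Relation.Unary.All as All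
open import Data.List.Relation.Unary.All.Properties using (++⁻ˡ; ++⁻ʳ)
open import Data.Product using (_×_; _,_; uncurry)
open import Data.Sum using (inj₁; inj₂)
open import Data.Empty using (⊥-elim)
open import Relation.Nullary using (Dec; yes; no)
open import Relation.Nullary.Decidable using (map′; _×-dec_)
open import Relation.Binary.PropositionalEquality using (_≡_; _≢_; refl; cong; cong₂)

variable
  i : ℕ
  a b : Fm
  φ ψ θ : Fm
  B C : Branch
  Γ : Fm → Set

-- Decidable equality of formulas (needed to update a valuation at one atom).
infix 3 _≟_
_≟_ : (φ ψ : Fm) → Dec (φ ≡ ψ)
var p ≟ var q = map′ (cong var) (λ { refl → refl }) (p ℕ.≟ q)
var _ ≟ ⊥' = no λ ()
var _ ≟ ¬' _ = no λ ()
var _ ≟ _ ⊃ _ = no λ ()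
var _ ≟ _ ∧' _ = no λ ()
var _ ≟ _ ∨' _ = no λ ()
var _ ≟ □ _ _ = no λ ()
⊥' ≟ var _ = no λ ()
⊥' ≟ ⊥' = yes refl
⊥' ≟ ¬' _ = no λ ()
⊥' ≟ _ ⊃ _ = no λ ()
⊥' ≟ _ ∧' _ = no λ ()
⊥' ≟ _ ∨' _ = no λ ()
⊥' ≟ □ _ _ = no λ ()
¬' _ ≟ var _ = no λ ()
¬' _ ≟ ⊥' = no λ ()
¬' φ ≟ ¬' ψ = map′ (cong ¬') (λ { refl → refl }) (φ ≟ ψ)
¬' _ ≟ _ ⊃ _ = no λ ()
¬' _ ≟ _ ∧' _ = no λ ()
¬' _ ≟ _ ∨' _ = no λ ()
¬' _ ≟ □ _ _ = no λ ()
_ ⊃ _ ≟ var _ = no λ ()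
_ ⊃ _ ≟ ⊥' = no λ ()
_ ⊃ _ ≟ ¬' _ = no λ ()
φ ⊃ ψ ≟ φ′ ⊃ ψ′ = map′ (uncurry (cong₂ _⊃_)) (λ { refl → refl , refl }) (φ ≟ φ′ ×-dec ψ ≟ ψ′)
_ ⊃ _ ≟ _ ∧' _ = no λ ()
_ ⊃ _ ≟ _ ∨' _ = no λ ()
_ ⊃ _ ≟ □ _ _ = no λ ()
_ ∧' _ ≟ var _ = no λ ()
_ ∧' _ ≟ ⊥' = no λ ()
_ ∧' _ ≟ ¬' _ = no λ ()
_ ∧' _ ≟ _ ⊃ _ = no λ ()
φ ∧' ψ ≟ φ′ ∧' ψ′ = map′ (uncurry (cong₂ _∧'_)) (λ { refl → refl , refl }) (φ ≟ φ′ ×-dec ψ ≟ ψ′)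
_ ∧' _ ≟ _ ∨' _ = no λ ()
_ ∧' _ ≟ □ _ _ = no λ ()
_ ∨' _ ≟ var _ = no λ ()
_ ∨' _ ≟ ⊥' = no λ ()
_ ∨' _ ≟ ¬' _ = no λ ()
_ ∨' _ ≟ _ ⊃ _ = no λ ()
_ ∨' _ ≟ _ ∧' _ = no λ ()
φ ∨' ψ ≟ φ′ ∨' ψ′ = map′ (uncurry (cong₂ _∨'_)) (λ { refl → refl , refl }) (φ ≟ φ′ ×-dec ψ ≟ ψ′)
_ ∨' _ ≟ □ _ _ = no λ ()
□ _ _ ≟ var _ = no λ ()
□ _ _ ≟ ⊥' = no λ ()
□ _ _ ≟ ¬' _ = no λ ()
□ _ _ ≟ _ ⊃ _ = no λ ()
□ _ _ ≟ _ ∧' _ = no λ ()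
□ _ _ ≟ _ ∨' _ = no λ ()
□ φ ψ ≟ □ φ′ ψ′ = map′ (uncurry (cong₂ □)) (λ { refl → refl , refl }) (φ ≟ φ′ ×-dec ψ ≟ ψ′)

atoms : Fm → List Fm
atoms (var p)  = var p ∷ []
atoms ⊥'       = []
atoms (¬' φ)   = atoms φ
atoms (φ ⊃ ψ)  = atoms φ ++ atoms ψ
atoms (φ ∧' ψ) = atoms φ ++ atoms ψ
atoms (φ ∨' ψ) = atoms φ ++ atoms ψ
atoms (□ φ ψ)  = □ φ ψ ∷ []

signed : Bool → Fm → Fm
signed true  a = a
signed false a = ¬' a

assign : (Fm → Bool) → Fm → Bool → Fm → Bool
assign v a s b with b ≟ a
... | yes _ = s
... | no _  = v b

branchIndices : Branch → List ℕ
branchIndices B = concat (map indices B)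

newIndex : Branch → ℕ
newIndex B = suc (max 0 (branchIndices B))

newIndex-fresh : ∀ B → Fresh (newIndex B) B
newIndex-fresh B occ =
  ℕ.1+n≰n (All.lookup (xs≤max 0 (branchIndices B)) (∈-concat⁺ (map⁺ occ)))

occurs : (i ▷ φ) ∈ B → Occurs i B
occurs = Any.map λ { refl → here refl }

module Tableau (ea : Bool) (A : PF → Set) where

  Closable : Branch → Set
  Closable = Closes ea A

  close : (i ▷ φ) ∈ B → (i ▷ ¬' φ) ∈ B → Closable B
  close {i = i} {φ = φ} p n = done (inj₁ (i , φ , p , n))

  close⊥ : (i ▷ ⊥') ∈ B → Closable B
  close⊥ {i = i} m = done (inj₂ (i , m))

  clash : ∀ s → (i ▷ signed s a) ∈ B → (i ▷ signed (not s) a) ∈ B → Closable B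
  clash true  p n = close p n
  clash false n p = close p n

  -- The tableau rules in continuation-passing style: each continuation
  -- receives the extended branch C ⊇ B and the new formulas on it.
  ∧-rule : (i ▷ φ ∧' ψ) ∈ B
         → (∀ {C} → B ⊆ C → (i ▷ φ) ∈ C → (i ▷ ψ) ∈ C → Closable C) → Closable B
  ∧-rule m k = apply (r∧ m) (k (λ x → there (there x)) (here refl) (there (here refl)) ∷ [])

  ¬∧-rule : (i ▷ ¬' (φ ∧' ψ)) ∈ B
          → (∀ {C} → B ⊆ C → (i ▷ ¬' φ) ∈ C → Closable C)
          → (∀ {C} → B ⊆ C → (i ▷ ¬' ψ) ∈ C → Closable C) → Closable B
  ¬∧-rule m k₁ k₂ = apply (r¬∧ m) (k₁ there (here refl) ∷ k₂ there (here refl) ∷ [])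

  ∨-rule : (i ▷ φ ∨' ψ) ∈ B
         → (∀ {C} → B ⊆ C → (i ▷ φ) ∈ C → Closable C)
         → (∀ {C} → B ⊆ C → (i ▷ ψ) ∈ C → Closable C) → Closable B
  ∨-rule m k₁ k₂ = apply (r∨ m) (k₁ there (here refl) ∷ k₂ there (here refl) ∷ [])

  ¬∨-rule : (i ▷ ¬' (φ ∨' ψ)) ∈ B
          → (∀ {C} → B ⊆ C → (i ▷ ¬' φ) ∈ C → (i ▷ ¬' ψ) ∈ C → Closable C) → Closable B
  ¬∨-rule m k = apply (r¬∨ m) (k (λ x → there (there x)) (here refl) (there (here refl)) ∷ [])

  ⊃-rule : (i ▷ φ ⊃ ψ) ∈ B
         → (∀ {C} → B ⊆ C → (i ▷ ¬' φ) ∈ C → Closable C)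
         → (∀ {C} → B ⊆ C → (i ▷ ψ) ∈ C → Closable C) → Closable B
  ⊃-rule m k₁ k₂ = apply (r⊃ m) (k₁ there (here refl) ∷ k₂ there (here refl) ∷ [])

  ¬⊃-rule : (i ▷ ¬' (φ ⊃ ψ)) ∈ B
          → (∀ {C} → B ⊆ C → (i ▷ φ) ∈ C → (i ▷ ¬' ψ) ∈ C → Closable C) → Closable B
  ¬⊃-rule m k = apply (r¬⊃ m) (k (λ x → there (there x)) (here refl) (there (here refl)) ∷ [])

  ¬¬-rule : (i ▷ ¬' (¬' φ)) ∈ B → (∀ {C} → B ⊆ C → (i ▷ φ) ∈ C → Closable C) → Closable B
  ¬¬-rule m k = apply (r¬¬ m) (k there (here refl) ∷ [])

  □-rule : ∀ {j} → (i ▷ □ φ ψ) ∈ B → rel i φ j ∈ B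
         → (∀ {C} → B ⊆ C → (j ▷ ψ) ∈ C → Closable C) → Closable B
  □-rule m r k = apply (r□ m r) (k there (here refl) ∷ [])

  ¬□-rule : (i ▷ ¬' (□ φ ψ)) ∈ B
          → (∀ {C j} → B ⊆ C → rel i φ j ∈ C → (j ▷ ¬' ψ) ∈ C → Closable C) → Closable B
  ¬□-rule {B = B} m k =
    apply (r¬□ m (newIndex-fresh B)) (k (λ x → there (there x)) (here refl) (there (here refl)) ∷ [])

  cut-rule : ∀ φ → Occurs i B
           → (∀ {C} → B ⊆ C → (i ▷ φ) ∈ C → Closable C)
           → (∀ {C} → B ⊆ C → (i ▷ ¬' φ) ∈ C → Closable C) → Closable B
  cut-rule φ o k₁ k₂ = apply (cut φ o) (k₁ there (here refl) ∷ k₂ there (here refl) ∷ [])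

  ea-rule : ∀ {j} → T ea → rel i φ j ∈ B → ∀ ψ
          → (∀ {C k} → B ⊆ C → (k ▷ ¬' φ) ∈ C → (k ▷ ψ) ∈ C → Closable C)
          → (∀ {C k} → B ⊆ C → (k ▷ φ) ∈ C → (k ▷ ¬' ψ) ∈ C → Closable C)
          → (∀ {C} → B ⊆ C → rel i ψ j ∈ C → Closable C) → Closable B
  ea-rule {B = B} t r ψ k₁ k₂ k₃ =
    apply (rea ψ t r (newIndex-fresh B))
      ( k₁ (λ x → there (there x)) (here refl) (there (here refl))
      ∷ k₂ (λ x → there (there x)) (here refl) (there (here refl))
      ∷ k₃ there (here refl) ∷ [])

  Refutable : ℕ → Fm → Set
  Refutable i φ = ∀ B → Closable ((i ▷ ¬' φ) ∷ B)

  Valid : Fm → Set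
  Valid φ = ∀ {i} → Refutable i φ

  Entails : Fm → Fm → Set
  Entails φ ψ = ∀ {i B} → (i ▷ φ) ∈ B → (i ▷ ¬' ψ) ∈ B → Closable B

  assert : Refutable i φ → Occurs i B
         → (∀ {C} → B ⊆ C → (i ▷ φ) ∈ C → Closable C) → Closable B
  assert {φ = φ} {B = B} r o k = apply (cut φ o) (k there (here refl) ∷ r B ∷ [])

  ∧-refutable : Refutable i φ → Refutable i ψ → Refutable i (φ ∧' ψ)
  ∧-refutable rφ rψ B = apply (r¬∧ (here refl)) (rφ _ ∷ rψ _ ∷ [])

  ⊃-refutable : (∀ {B} → (i ▷ φ) ∈ B → (i ▷ ¬' ψ) ∈ B → Closable B) → Refutable i (φ ⊃ ψ)
  ⊃-refutable e B = ¬⊃-rule (here refl) λ _ mφ m¬ψ → e mφ m¬ψ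

  mp-closes : (i ▷ φ ⊃ ψ) ∈ B → (i ▷ φ) ∈ B → (i ▷ ¬' ψ) ∈ B → Closable B
  mp-closes imp mφ m¬ψ = ⊃-rule imp (λ s m¬φ → close (s mφ) m¬φ) (λ s mψ → close mψ (s m¬ψ))

  ∧-validˡ : Valid (φ ∧' ψ) → Valid φ
  ∧-validˡ v B = assert v (occurs (here refl)) λ s m → ∧-rule m λ s′ mφ _ → close mφ (s′ (s (here refl)))

  ∧-validʳ : Valid (φ ∧' ψ) → Valid ψ
  ∧-validʳ v B = assert v (occurs (here refl)) λ s m → ∧-rule m λ s′ _ mψ → close mψ (s′ (s (here refl)))

  ⊃-valid : Valid (φ ⊃ ψ) → Entails φ ψ
  ⊃-valid v mφ m¬ψ = assert v (occurs mφ) λ s imp → mp-closes imp (s mφ) (s m¬ψ)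

  ∧-entailsˡ : Entails (φ ∧' ψ) φ
  ∧-entailsˡ m n = ∧-rule m λ s mφ _ → close mφ (s n)

  ∧-entailsʳ : Entails (φ ∧' ψ) ψ
  ∧-entailsʳ m n = ∧-rule m λ s _ mψ → close mψ (s n)

  □-mono-closes : Entails ψ θ → (i ▷ □ φ ψ) ∈ B → (i ▷ ¬' (□ φ θ)) ∈ B → Closable B
  □-mono-closes e box ¬box =
    ¬□-rule ¬box λ s r m¬θ → □-rule (s box) r λ s′ mψ → e mψ (s′ m¬θ)

  -- With (ea), mutually entailing antecedents φ, ψ make □_φ θ and ¬□_ψ θ clash:
  -- the new world j reached by r_ψ is also reached by r_φ.
  □-antecedent-closes : T ea → Entails φ ψ → Entails ψ φ
                      → (i ▷ □ φ θ) ∈ B → (i ▷ ¬' (□ ψ θ)) ∈ B → Closable B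
  □-antecedent-closes {φ = φ} t φ⊨ψ ψ⊨φ box ¬box =
    ¬□-rule ¬box λ s r m¬θ → ea-rule t r φ
      (λ _ m¬ψ mφ → φ⊨ψ mφ m¬ψ)
      (λ _ mψ m¬φ → ψ⊨φ mψ m¬φ)
      (λ s′ r′ → □-rule (s′ (s box)) r′ λ s″ mθ → close mθ (s″ (s′ m¬θ)))

  -- CM: a world j with ¬ψ (or ¬θ) reached by r_φ also carries ψ ∧ θ.
  CM-refutable : Refutable i (□ φ (ψ ∧' θ) ⊃ (□ φ ψ ∧' □ φ θ))
  CM-refutable B = ¬⊃-rule (here refl) λ _ box ¬both →
    ¬∧-rule ¬both (λ s → □-mono-closes ∧-entailsˡ (s box)) (λ s → □-mono-closes ∧-entailsʳ (s box))

  -- CC: the world j with ¬(ψ ∧ θ) reached by r_φ carries both ψ and θ.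
  CC-refutable : Refutable i ((□ φ ψ ∧' □ φ θ) ⊃ □ φ (ψ ∧' θ))
  CC-refutable B = ¬⊃-rule (here refl) λ _ both ¬box → ∧-rule both λ s boxψ boxθ →
    ¬□-rule (s ¬box) λ s₁ r m¬ψθ → □-rule (s₁ boxψ) r λ s₂ mψ → □-rule (s₂ (s₁ boxθ)) (s₂ r) λ s₃ mθ →
    ¬∧-rule (s₃ (s₂ m¬ψθ)) (λ s₄ m¬ψ → close (s₄ (s₃ mψ)) m¬ψ) (λ s₄ m¬θ → close (s₄ mθ) m¬θ)

  CN-refutable : Refutable i (□ φ ⊤')
  CN-refutable B = ¬□-rule (here refl) λ _ _ m¬⊤ → ¬¬-rule m¬⊤ λ _ → close⊥

  RCEC-refutable : Valid (ψ ≣ θ) → Refutable i (□ φ ψ ≣ □ φ θ)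
  RCEC-refutable v =
    ∧-refutable (⊃-refutable (□-mono-closes (⊃-valid (∧-validˡ v))))
                (⊃-refutable (□-mono-closes (⊃-valid (∧-validʳ v))))

  RCEA-refutable : T ea → Valid (φ ≣ ψ) → Refutable i (□ φ θ ≣ □ ψ θ)
  RCEA-refutable t v =
    ∧-refutable (⊃-refutable (□-antecedent-closes t (⊃-valid (∧-validˡ v)) (⊃-valid (∧-validʳ v))))
                (⊃-refutable (□-antecedent-closes t (⊃-valid (∧-validʳ v)) (⊃-valid (∧-validˡ v))))

  Decides : (Fm → Bool) → ℕ → Branch → Fm → Set
  Decides v i B a = (i ▷ signed (v a) a) ∈ B

  assign-decides : ∀ v s b → (i ▷ signed s a) ∈ B → (b ≢ a → Decides v i B b)
                 → Decides (assign v a s) i B b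
  assign-decides {a = a} v s b m d with b ≟ a
  ... | yes refl = m
  ... | no b≢a   = d b≢a

  decide-atoms : ∀ as → Occurs i B
               → (∀ {C} v → B ⊆ C → All (Decides v i C) as → Closable C) → Closable B
  decide-atoms [] _ k = k (λ _ → true) ⊆-refl []
  decide-atoms {i = i} {B = B} (a ∷ as) o k = cut-rule a o (extend true) (extend false)
    where
    extend : ∀ s {C} → B ⊆ C → (i ▷ signed s a) ∈ C → Closable C
    extend s B⊆C m = decide-atoms as (occurs m) λ v C⊆D ds →
      k (assign v a s) (⊆-trans B⊆C C⊆D)
        ( assign-decides v s a (C⊆D m) (λ a≢a → ⊥-elim (a≢a refl))
        ∷ All.map (λ {b} d → assign-decides v s b (C⊆D m) λ _ → d) ds)

  refute : ∀ v χ {s} → eval v χ ≡ s → All (Decides v i B) (atoms χ) → B ⊆ C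
         → (i ▷ signed (not s) χ) ∈ C → Closable C
  refute v (var p) refl (d ∷ []) B⊆C m = clash (v (var p)) (B⊆C d) m
  refute v (□ φ ψ) refl (d ∷ []) B⊆C m = clash (v (□ φ ψ)) (B⊆C d) m
  refute v ⊥' refl [] _ m = close⊥ m
  refute v (¬' χ) e ds B⊆C m with eval v χ in eχ
  refute v (¬' χ) refl ds B⊆C m | true  = refute v χ eχ ds B⊆C m
  refute v (¬' χ) refl ds B⊆C m | false =
    ¬¬-rule m λ s mχ → refute v χ eχ ds (⊆-trans B⊆C s) mχ
  refute v (χ ∧' ψ) e ds B⊆C m with eval v χ in eχ | eval v ψ in eψ
  refute v (χ ∧' ψ) refl ds B⊆C m | false | _ =
    ∧-rule m λ s mχ _ → refute v χ eχ (++⁻ˡ (atoms χ) ds) (⊆-trans B⊆C s) mχ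
  refute v (χ ∧' ψ) refl ds B⊆C m | true | false =
    ∧-rule m λ s _ mψ → refute v ψ eψ (++⁻ʳ (atoms χ) ds) (⊆-trans B⊆C s) mψ
  refute v (χ ∧' ψ) refl ds B⊆C m | true | true = ¬∧-rule m
    (λ s m¬χ → refute v χ eχ (++⁻ˡ (atoms χ) ds) (⊆-trans B⊆C s) m¬χ)
    (λ s m¬ψ → refute v ψ eψ (++⁻ʳ (atoms χ) ds) (⊆-trans B⊆C s) m¬ψ)
  refute v (χ ∨' ψ) e ds B⊆C m with eval v χ in eχ | eval v ψ in eψ
  refute v (χ ∨' ψ) refl ds B⊆C m | true | _ =
    ¬∨-rule m λ s m¬χ _ → refute v χ eχ (++⁻ˡ (atoms χ) ds) (⊆-trans B⊆C s) m¬χ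
  refute v (χ ∨' ψ) refl ds B⊆C m | false | true =
    ¬∨-rule m λ s _ m¬ψ → refute v ψ eψ (++⁻ʳ (atoms χ) ds) (⊆-trans B⊆C s) m¬ψ
  refute v (χ ∨' ψ) refl ds B⊆C m | false | false = ∨-rule m
    (λ s mχ → refute v χ eχ (++⁻ˡ (atoms χ) ds) (⊆-trans B⊆C s) mχ)
    (λ s mψ → refute v ψ eψ (++⁻ʳ (atoms χ) ds) (⊆-trans B⊆C s) mψ)
  refute v (χ ⊃ ψ) e ds B⊆C m with eval v χ in eχ | eval v ψ in eψ
  refute v (χ ⊃ ψ) refl ds B⊆C m | false | _ =
    ¬⊃-rule m λ s mχ _ → refute v χ eχ (++⁻ˡ (atoms χ) ds) (⊆-trans B⊆C s) mχ
  refute v (χ ⊃ ψ) refl ds B⊆C m | true | true =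
    ¬⊃-rule m λ s _ m¬ψ → refute v ψ eψ (++⁻ʳ (atoms χ) ds) (⊆-trans B⊆C s) m¬ψ
  refute v (χ ⊃ ψ) refl ds B⊆C m | true | false = ⊃-rule m
    (λ s m¬χ → refute v χ eχ (++⁻ˡ (atoms χ) ds) (⊆-trans B⊆C s) m¬χ)
    (λ s mψ → refute v ψ eψ (++⁻ʳ (atoms χ) ds) (⊆-trans B⊆C s) mψ)

  tautology-refutable : Tautology φ → Refutable i φ
  tautology-refutable {φ = φ} t B =
    decide-atoms (atoms φ) (occurs (here refl)) λ v s ds → refute v φ (t v) ds ⊆-refl (s (here refl))

  derivable-refutable : Der ea Γ φ → (∀ {ψ} → Γ ψ → A (i ▷ ψ)) → Refutable i φ
  derivable-refutable (prem g) hyp B = assume (hyp g) (close (here refl) (there (here refl)))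
  derivable-refutable (taut t) _ = tautology-refutable t
  derivable-refutable CM _ = CM-refutable
  derivable-refutable CC _ = CC-refutable
  derivable-refutable CN _ = CN-refutable
  derivable-refutable (mp d₁ d₂) hyp B =
    assert (derivable-refutable d₂ hyp) (occurs (here refl)) λ s mφ →
    assert (derivable-refutable d₁ hyp) (occurs mφ) λ s′ imp →
    mp-closes imp (s′ mφ) (s′ (s (here refl)))
  derivable-refutable (RCEC d) _ = RCEC-refutable (derivable-refutable d λ ())
  derivable-refutable (RCEA t d) _ = RCEA-refutable t (derivable-refutable d λ ())

derivable⇒closed-tableau : ∀ {ea} → Der ea Γ φ → Γ ⊢T[ ea ] φ
derivable⇒closed-tableau {Γ = Γ} {φ = φ} {ea = ea} d =
  assume (inj₂ refl) (derivable-refutable d (λ g → inj₁ (_ , g , refl)) [])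
  where open Tableau ea (Assumptions Γ φ)

theorem1 : ((Γ : Fm → Set) (φ : Fm) → Der false Γ φ → Γ ⊢T[ false ] φ)
         × ((Γ : Fm → Set) (φ : Fm) → Der true Γ φ → Γ ⊢T[ true ] φ)
theorem1 = (λ _ _ → derivable⇒closed-tableau) , (λ _ _ → derivable⇒closed-tableau)
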